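{- Let $M(\mathit{odd})=\{(r^2+r)g(r^2): g\in\mathbb{Z}/2[t]\}$ and $K=\{f\in M(\mathit{odd}): U(f)=f\}$. Let $N2$ be the $\mathbb{Z}/2[G^2]$-submodule of $\mathbb{Z}/2[r]$ generated by $G$, $F$, $F^2G$. Then $K\subseteq N2$.
   Context: $\mathbb{Z}/2[r]$, $\mathbb{Z}/2[t]$ are polynomial rings over the field with two elements; $F=r(r+1)^3$, $G=r^3(r+1)$. $\mathbb{Z}/2[r]$ is a free $\mathbb{Z}/2[G]$-module with basis $1,r,r^2,r^3$. $U:\mathbb{Z}/2[r]\to\mathbb{Z}/2[r]$ is $U\big(\sum_{i=0}^3 g_i(G)r^i\big)=\sum_{i=0}^3 g_i(F)U(r^i)$ with $U(1)=1$, $U(r)=r$, $U(r^2)=r^2$, $U(r^3)=r^3+r^2+r$. -}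

module Defs where

open import Data.Bool using (Bool; true; false; _xor_)
open import Data.List using (List; []; _∷_)
open import Data.Nat using (ℕ; zero; suc)
open import Data.Product using (∃-syntax; _×_)
open import Relation.Binary.PropositionalEquality using (_≡_)

-- Polynomials over ℤ/2 : coefficient lists, lowest degree first.
-- Trailing zero coefficients are allowed; equality is coefficientwise (_≈_).
Poly : Set
Poly = List Bool

coeff : Poly → ℕ → Bool
coeff []      _       = false
coeff (a ∷ p) zero    = a
coeff (a ∷ p) (suc n) = coeff p n

infix 4 _≈_
_≈_ : Poly → Poly → Set
p ≈ q = ∀ n → coeff p n ≡ coeff q n

infixl 6 _+ₚ_
infixl 7 _*ₚ_

_+ₚ_ : Poly → Poly → Poly
[]      +ₚ q       = q
(a ∷ p) +ₚ []      = a ∷ p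
(a ∷ p) +ₚ (b ∷ q) = (a xor b) ∷ (p +ₚ q)

_*ₚ_ : Poly → Poly → Poly
[]      *ₚ q = []
(a ∷ p) *ₚ q = (if a then q else []) +ₚ (false ∷ (p *ₚ q))
  where
  open import Data.Bool using (if_then_else_)

_∘ₚ_ : Poly → Poly → Poly
[]      ∘ₚ q = []
(a ∷ p) ∘ₚ q = (a ∷ []) +ₚ (q *ₚ (p ∘ₚ q))

one : Poly
one = true ∷ []

-- the variable r (also used as the variable t)
r : Poly
r = false ∷ true ∷ []

_^ₚ_ : Poly → ℕ → Poly
p ^ₚ zero  = one
p ^ₚ suc n = p *ₚ (p ^ₚ n)

F : Poly
F = r *ₚ ((r +ₚ one) ^ₚ 3)

G : Poly
G = (r ^ₚ 3) *ₚ (r +ₚ one)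

U1 Ur Ur2 Ur3 : Poly
U1  = one
Ur  = r
Ur2 = r ^ₚ 2
Ur3 = (r ^ₚ 3) +ₚ (r ^ₚ 2) +ₚ r

IsGDecomp : Poly → Poly → Poly → Poly → Poly → Set
IsGDecomp f g0 g1 g2 g3 =
  f ≈ (g0 ∘ₚ G) +ₚ (g1 ∘ₚ G) *ₚ r +ₚ (g2 ∘ₚ G) *ₚ (r ^ₚ 2) +ₚ (g3 ∘ₚ G) *ₚ (r ^ₚ 3)

UFromDecomp : Poly → Poly → Poly → Poly → Poly
UFromDecomp g0 g1 g2 g3 =
  (g0 ∘ₚ F) *ₚ U1 +ₚ (g1 ∘ₚ F) *ₚ Ur +ₚ (g2 ∘ₚ F) *ₚ Ur2 +ₚ (g3 ∘ₚ F) *ₚ Ur3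

-- U(f) ≈ u.  Since ℤ/2[r] is free over ℤ/2[G] with basis 1,r,r²,r³,
-- the decomposition exists and is unique, so this is the graph of U.
UMaps : Poly → Poly → Set
UMaps f u = ∃[ g0 ] ∃[ g1 ] ∃[ g2 ] ∃[ g3 ]
  (IsGDecomp f g0 g1 g2 g3 × u ≈ UFromDecomp g0 g1 g2 g3)

InMOdd : Poly → Set
InMOdd f = ∃[ g ] f ≈ ((r ^ₚ 2) +ₚ r) *ₚ (g ∘ₚ (r ^ₚ 2))

InK : Poly → Set
InK f = InMOdd f × UMaps f f

InN2 : Poly → Set
InN2 f = ∃[ a ] ∃[ b ] ∃[ c ]
  (f ≈ (a ∘ₚ (G ^ₚ 2)) *ₚ G +ₚ (b ∘ₚ (G ^ₚ 2)) *ₚ F +ₚ (c ∘ₚ (G ^ₚ 2)) *ₚ ((F ^ₚ 2) *ₚ G))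

{-# OPTIONS --safe #-}
module Submission where

-- Write f = (r² + r) g(r²).  As r⁸ = G² + r⁶, g(r²) has coordinates Aᵢ over ℤ/2[G²] in the basis
-- 1, r², r⁴, r⁶, and this gives explicit coordinates hᵢ of f over ℤ/2[G]; by freeness they are the
-- gᵢ used to define U f.  The substitution σ : r ↦ r + 1 swaps F and G, and σ f = U f + T(F),
-- σ(U f) = f + T(G) with T = g₁ + g₂ + g₃; so U f = f gives T(G) = T(F).  Here T = r·Y with
-- Y = (A₂ + A₃)(r²), i.e. G·Y(G) = F·Y(F), which forces Y = 0 since G vanishes to order 3 at r = 0
-- and F only to order 1.  Hence A₂(G²) = A₃(G²), and then
-- (r² + r)(a₀ + a₁r² + a₂r⁴ + a₂r⁶) = (a₀ + a₁ + G²a₂)G + a₀F + a₂F²G  with aᵢ = Aᵢ(G²).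

open import Algebra.Bundles using (CommutativeSemigroup; CommutativeSemiring; RawRing)
open import Algebra.Structures using (IsCommutativeMonoid)
open import Algebra.Structures.Biased using (IsCommutativeSemiringˡ)
open import Algebra.Solver.Ring.AlmostCommutativeRing
  using (AlmostCommutativeRing; _-Raw-AlmostCommutative⟶_; fromCommutativeSemiring)
import Algebra.Properties.CommutativeSemigroup as CommutativeSemigroupProperties
import Algebra.Solver.Ring as RingSolver
open import Data.Bool using (Bool; true; false; _xor_; _∧_; not; T; if_then_else_)
import Data.Bool.Properties as Bool
open import Data.List using ([]; _∷_; length)
open import Data.Maybe using (just; nothing)
open import Data.Nat using (zero; suc)
open import Data.Product using (_×_; _,_; proj₁; proj₂)
open import Function using (id)
open import Level using (0ℓ)
open import Relation.Binary using (IsEquivalence; Setoid)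
open import Relation.Binary.Definitions using (WeaklyDecidable)
open import Relation.Binary.PropositionalEquality using (_≡_; refl; sym; trans; cong; cong₂; module ≡-Reasoning)
open import Relation.Nullary using (yes; no)
import Relation.Binary.Reasoning.Setoid as SetoidReasoning

open import Defs

-- The commutative semiring ℤ/2[r]

-- Wrapping the coefficientwise equality in a record keeps Agda from unfolding it to a Π-type,
-- so that its two sides can be inferred.
infix 4 _≋_
record _≋_ (p q : Poly) : Set where
  constructor mk≋
  field coeff-≡ : p ≈ q
open _≋_

≋-refl : ∀ {p} → p ≋ p
≋-refl = mk≋ λ _ → refl

≋-sym : ∀ {p q} → p ≋ q → q ≋ p
≋-sym (mk≋ e) = mk≋ λ n → sym (e n)

≋-trans : ∀ {p q s} → p ≋ q → q ≋ s → p ≋ s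
≋-trans (mk≋ e) (mk≋ f) = mk≋ λ n → trans (e n) (f n)

≋-reflexive : ∀ {p q} → p ≡ q → p ≋ q
≋-reflexive refl = ≋-refl

≋-isEquivalence : IsEquivalence _≋_
≋-isEquivalence = record { refl = ≋-refl ; sym = ≋-sym ; trans = ≋-trans }

≋-setoid : Setoid 0ℓ 0ℓ
≋-setoid = record { isEquivalence = ≋-isEquivalence }

∷-cong : ∀ {a p q} → p ≋ q → a ∷ p ≋ a ∷ q
∷-cong (mk≋ e) = mk≋ λ { zero → refl ; (suc n) → e n }

∷-injective : ∀ {a b p q} → a ∷ p ≋ b ∷ q → a ≡ b × p ≋ q
∷-injective (mk≋ e) = e zero , mk≋ λ n → e (suc n)

[]≋∷ : ∀ {b p} → [] ≋ b ∷ p → false ≡ b × [] ≋ p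
[]≋∷ (mk≋ e) = e zero , mk≋ λ n → e (suc n)

false∷[]≋[] : false ∷ [] ≋ []
false∷[]≋[] = mk≋ λ { zero → refl ; (suc n) → refl }

coeff-+ : ∀ p q n → coeff (p +ₚ q) n ≡ coeff p n xor coeff q n
coeff-+ []      q       n       = refl
coeff-+ (a ∷ p) []      n       = sym (Bool.xor-identityʳ _)
coeff-+ (a ∷ p) (b ∷ q) zero    = refl
coeff-+ (a ∷ p) (b ∷ q) (suc n) = coeff-+ p q n

+-cong : ∀ {p p′ q q′} → p ≋ p′ → q ≋ q′ → p +ₚ q ≋ p′ +ₚ q′
+-cong {p} {p′} {q} {q′} (mk≋ e) (mk≋ f) = mk≋ λ n → begin
  coeff (p +ₚ q) n          ≡⟨ coeff-+ p q n ⟩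
  coeff p n xor coeff q n   ≡⟨ cong₂ _xor_ (e n) (f n) ⟩
  coeff p′ n xor coeff q′ n ≡⟨ coeff-+ p′ q′ n ⟨
  coeff (p′ +ₚ q′) n        ∎
  where open ≡-Reasoning

+-assoc : ∀ p q s → (p +ₚ q) +ₚ s ≋ p +ₚ (q +ₚ s)
+-assoc p q s = mk≋ λ n → begin
  coeff ((p +ₚ q) +ₚ s) n                     ≡⟨ coeff-+ (p +ₚ q) s n ⟩
  coeff (p +ₚ q) n xor coeff s n              ≡⟨ cong (_xor coeff s n) (coeff-+ p q n) ⟩
  (coeff p n xor coeff q n) xor coeff s n     ≡⟨ Bool.xor-assoc (coeff p n) (coeff q n) (coeff s n) ⟩
  coeff p n xor (coeff q n xor coeff s n)     ≡⟨ cong (coeff p n xor_) (coeff-+ q s n) ⟨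
  coeff p n xor coeff (q +ₚ s) n              ≡⟨ coeff-+ p (q +ₚ s) n ⟨
  coeff (p +ₚ (q +ₚ s)) n                     ∎
  where open ≡-Reasoning

+-comm : ∀ p q → p +ₚ q ≋ q +ₚ p
+-comm p q = mk≋ λ n → begin
  coeff (p +ₚ q) n        ≡⟨ coeff-+ p q n ⟩
  coeff p n xor coeff q n ≡⟨ Bool.xor-comm (coeff p n) (coeff q n) ⟩
  coeff q n xor coeff p n ≡⟨ coeff-+ q p n ⟨
  coeff (q +ₚ p) n        ∎
  where open ≡-Reasoning

+-identityʳ : ∀ p → p +ₚ [] ≋ p
+-identityʳ p = mk≋ λ n → trans (coeff-+ p [] n) (Bool.xor-identityʳ (coeff p n))

∷-+-false∷ : ∀ a p q → (a ∷ p) +ₚ (false ∷ q) ≋ a ∷ (p +ₚ q)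
∷-+-false∷ a p q = mk≋ λ { zero → Bool.xor-identityʳ a ; (suc n) → refl }

+-self : ∀ p → p +ₚ p ≋ []
+-self p = mk≋ λ n → trans (coeff-+ p p n) (Bool.xor-same (coeff p n))

+-isCommutativeMonoid : IsCommutativeMonoid _≋_ _+ₚ_ []
+-isCommutativeMonoid = record
  { isMonoid = record
    { isSemigroup = record
      { isMagma = record { isEquivalence = ≋-isEquivalence ; ∙-cong = +-cong }
      ; assoc   = +-assoc
      }
    ; identity = (λ _ → ≋-refl) , +-identityʳ
    }
  ; comm = +-comm
  }

+-commutativeSemigroup : CommutativeSemigroup 0ℓ 0ℓ
+-commutativeSemigroup = record
  { isCommutativeSemigroup = IsCommutativeMonoid.isCommutativeSemigroup +-isCommutativeMonoid }

open CommutativeSemigroupProperties +-commutativeSemigroup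
  using () renaming (interchange to +-interchange; x∙yz≈y∙xz to +-leftComm)

scale : Bool → Poly → Poly
scale a q = if a then q else []

scale-cong : ∀ a {q q′} → q ≋ q′ → scale a q ≋ scale a q′
scale-cong true  e = e
scale-cong false e = ≋-refl

scale-xor : ∀ a b q → scale (a xor b) q ≋ scale a q +ₚ scale b q
scale-xor true  true  q = ≋-sym (+-self q)
scale-xor true  false q = ≋-sym (+-identityʳ q)
scale-xor false b     q = ≋-refl

scale-∷ : ∀ a b q → scale a (b ∷ q) ≋ (a ∧ b) ∷ scale a q
scale-∷ true  b q = ≋-refl
scale-∷ false b q = ≋-sym false∷[]≋[]

scale-[] : ∀ a → scale a [] ≋ []
scale-[] true  = ≋-refl
scale-[] false = ≋-refl

scale-* : ∀ a p q → scale a p *ₚ q ≡ scale a (p *ₚ q)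
scale-* true  p q = refl
scale-* false p q = refl

*-zeroʳ : ∀ p → p *ₚ [] ≋ []
*-zeroʳ []      = ≋-refl
*-zeroʳ (a ∷ p) = ≋-trans (+-cong (scale-[] a) (∷-cong (*-zeroʳ p))) false∷[]≋[]

*-congˡ : ∀ {p p′} q → p ≋ p′ → p *ₚ q ≋ p′ *ₚ q
*-congˡ {[]}    {[]}      q e = ≋-refl
*-congˡ {[]}    {b ∷ p′}  q e with []≋∷ e
... | refl , e′ = ≋-sym (≋-trans (∷-cong (≋-sym (*-congˡ q e′))) false∷[]≋[])
*-congˡ {a ∷ p} {[]}      q e with []≋∷ (≋-sym e)
... | refl , e′ = ≋-trans (∷-cong (≋-sym (*-congˡ q e′))) false∷[]≋[]
*-congˡ {a ∷ p} {b ∷ p′}  q e with ∷-injective e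
... | refl , e′ = +-cong ≋-refl (∷-cong (*-congˡ q e′))

*-congʳ : ∀ p {q q′} → q ≋ q′ → p *ₚ q ≋ p *ₚ q′
*-congʳ []      e = ≋-refl
*-congʳ (a ∷ p) e = +-cong (scale-cong a e) (∷-cong (*-congʳ p e))

*-cong : ∀ {p p′ q q′} → p ≋ p′ → q ≋ q′ → p *ₚ q ≋ p′ *ₚ q′
*-cong {p′ = p′} {q} e f = ≋-trans (*-congˡ q e) (*-congʳ p′ f)

*-distribʳ : ∀ p q s → (q +ₚ s) *ₚ p ≋ q *ₚ p +ₚ s *ₚ p
*-distribʳ p []      s       = ≋-refl
*-distribʳ p (a ∷ q) []      = ≋-sym (+-identityʳ _)
*-distribʳ p (a ∷ q) (b ∷ s) = begin
  scale (a xor b) p +ₚ (false ∷ ((q +ₚ s) *ₚ p))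
    ≈⟨ +-cong (scale-xor a b p) (∷-cong (*-distribʳ p q s)) ⟩
  (scale a p +ₚ scale b p) +ₚ ((false ∷ (q *ₚ p)) +ₚ (false ∷ (s *ₚ p)))
    ≈⟨ +-interchange (scale a p) (scale b p) _ _ ⟩
  (scale a p +ₚ (false ∷ (q *ₚ p))) +ₚ (scale b p +ₚ (false ∷ (s *ₚ p))) ∎
  where open SetoidReasoning ≋-setoid

*-assoc : ∀ p q s → (p *ₚ q) *ₚ s ≋ p *ₚ (q *ₚ s)
*-assoc []      q s = ≋-refl
*-assoc (a ∷ p) q s = begin
  (scale a q +ₚ (false ∷ (p *ₚ q))) *ₚ s       ≈⟨ *-distribʳ s (scale a q) (false ∷ (p *ₚ q)) ⟩
  scale a q *ₚ s +ₚ (false ∷ ((p *ₚ q) *ₚ s))  ≡⟨ cong (_+ₚ (false ∷ ((p *ₚ q) *ₚ s))) (scale-* a q s) ⟩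
  scale a (q *ₚ s) +ₚ (false ∷ ((p *ₚ q) *ₚ s)) ≈⟨ +-cong ≋-refl (∷-cong (*-assoc p q s)) ⟩
  scale a (q *ₚ s) +ₚ (false ∷ (p *ₚ (q *ₚ s))) ∎
  where open SetoidReasoning ≋-setoid

*-∷ʳ : ∀ p a q → p *ₚ (a ∷ q) ≋ scale a p +ₚ (false ∷ (p *ₚ q))
*-∷ʳ []      a q = ≋-sym (≋-trans (+-cong (scale-[] a) ≋-refl) false∷[]≋[])
*-∷ʳ (b ∷ p) a q = begin
  scale b (a ∷ q) +ₚ (false ∷ (p *ₚ (a ∷ q)))
    ≈⟨ +-cong (scale-∷ b a q) (∷-cong (*-∷ʳ p a q)) ⟩
  ((b ∧ a) ∷ scale b q) +ₚ (false ∷ (scale a p +ₚ (false ∷ (p *ₚ q))))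
    ≈⟨ ∷-+-false∷ (b ∧ a) (scale b q) (scale a p +ₚ (false ∷ (p *ₚ q))) ⟩
  (b ∧ a) ∷ (scale b q +ₚ (scale a p +ₚ (false ∷ (p *ₚ q))))
    ≡⟨ cong (_∷ (scale b q +ₚ (scale a p +ₚ (false ∷ (p *ₚ q))))) (Bool.∧-comm b a) ⟩
  (a ∧ b) ∷ (scale b q +ₚ (scale a p +ₚ (false ∷ (p *ₚ q))))
    ≈⟨ ∷-cong (+-leftComm (scale b q) (scale a p) (false ∷ (p *ₚ q))) ⟩
  (a ∧ b) ∷ (scale a p +ₚ (scale b q +ₚ (false ∷ (p *ₚ q))))
    ≈⟨ ∷-+-false∷ (a ∧ b) (scale a p) (scale b q +ₚ (false ∷ (p *ₚ q))) ⟨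
  ((a ∧ b) ∷ scale a p) +ₚ (false ∷ (scale b q +ₚ (false ∷ (p *ₚ q))))
    ≈⟨ +-cong (scale-∷ a b p) ≋-refl ⟨
  scale a (b ∷ p) +ₚ (false ∷ (scale b q +ₚ (false ∷ (p *ₚ q)))) ∎
  where open SetoidReasoning ≋-setoid

*-comm : ∀ p q → p *ₚ q ≋ q *ₚ p
*-comm []      q = ≋-sym (*-zeroʳ q)
*-comm (a ∷ p) q = ≋-trans (+-cong ≋-refl (∷-cong (*-comm p q))) (≋-sym (*-∷ʳ q a p))

*-identityˡ : ∀ p → one *ₚ p ≋ p
*-identityˡ p = ≋-trans (+-cong ≋-refl false∷[]≋[]) (+-identityʳ p)

*-identityʳ : ∀ p → p *ₚ one ≋ p
*-identityʳ p = ≋-trans (*-comm p one) (*-identityˡ p)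

*-isCommutativeMonoid : IsCommutativeMonoid _≋_ _*ₚ_ one
*-isCommutativeMonoid = record
  { isMonoid = record
    { isSemigroup = record
      { isMagma = record { isEquivalence = ≋-isEquivalence ; ∙-cong = *-cong }
      ; assoc   = *-assoc
      }
    ; identity = *-identityˡ , *-identityʳ
    }
  ; comm = *-comm
  }

Poly-commutativeSemiring : CommutativeSemiring 0ℓ 0ℓ
Poly-commutativeSemiring = record
  { isCommutativeSemiring = IsCommutativeSemiringˡ.isCommutativeSemiring record
    { +-isCommutativeMonoid = +-isCommutativeMonoid
    ; *-isCommutativeMonoid = *-isCommutativeMonoid
    ; distribʳ              = *-distribʳ
    ; zeroˡ                 = λ _ → ≋-refl
    }
  }

-- Coefficients in ℤ/2 rather than ℕ let the ring solver use 1 + 1 = 0.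

const : Bool → Poly
const a = a ∷ []

Bool-rawRing : RawRing 0ℓ 0ℓ
Bool-rawRing = record
  { _≈_ = _≡_ ; _+_ = _xor_ ; _*_ = _∧_ ; -_ = id ; 0# = false ; 1# = true }

Poly-almostCommutativeRing : AlmostCommutativeRing 0ℓ 0ℓ
Poly-almostCommutativeRing = fromCommutativeSemiring Poly-commutativeSemiring

const-homomorphism : Bool-rawRing -Raw-AlmostCommutative⟶ Poly-almostCommutativeRing
const-homomorphism = record
  { ⟦_⟧    = const
  ; +-homo = λ _ _ → ≋-refl
  ; *-homo = λ { true b → ≋-sym (∷-+-false∷ b [] []) ; false b → ≋-refl }
  ; -‿homo = λ _ → ≋-refl
  ; 0-homo = false∷[]≋[]
  ; 1-homo = ≋-refl
  }

const-≟ : WeaklyDecidable (λ a b → const a ≋ const b)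
const-≟ a b with a Bool.≟ b
... | yes refl = just ≋-refl
... | no _     = nothing

module PolySolver = RingSolver Bool-rawRing Poly-almostCommutativeRing const-homomorphism const-≟
open PolySolver using (solve; _:=_; _:+_; _:*_; _:^_; con)

+≋[]⇒≋ : ∀ {p q} → p +ₚ q ≋ [] → p ≋ q
+≋[]⇒≋ {p} {q} e = begin
  p              ≈⟨ solve 2 (λ P Q → P := (P :+ Q) :+ Q) ≋-refl p q ⟩
  (p +ₚ q) +ₚ q  ≈⟨ +-cong e ≋-refl ⟩
  q              ∎
  where open SetoidReasoning ≋-setoid

≋⇒+≋[] : ∀ {p q} → p ≋ q → p +ₚ q ≋ []
≋⇒+≋[] {p} e = ≋-trans (+-cong ≋-refl (≋-sym e)) (+-self p)

isZero : Poly → Bool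
isZero []      = true
isZero (a ∷ p) = not a ∧ isZero p

isZero-sound : ∀ p → T (isZero p) → p ≋ []
isZero-sound []          _ = ≋-refl
isZero-sound (false ∷ p) t = ≋-trans (∷-cong (isZero-sound p t)) false∷[]≋[]

by-computation : ∀ {p q} {_ : T (isZero (p +ₚ q))} → p ≋ q
by-computation {p} {q} {t} = +≋[]⇒≋ (isZero-sound (p +ₚ q) t)

coeff₀ : Poly → Bool
coeff₀ p = coeff p zero

tailₚ : Poly → Poly
tailₚ []      = []
tailₚ (a ∷ p) = p

coeff-tailₚ : ∀ p n → coeff (tailₚ p) n ≡ coeff p (suc n)
coeff-tailₚ []      n = refl
coeff-tailₚ (a ∷ p) n = refl

≋coeff₀∷tailₚ : ∀ p → p ≋ coeff₀ p ∷ tailₚ p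
≋coeff₀∷tailₚ []      = ≋-sym false∷[]≋[]
≋coeff₀∷tailₚ (a ∷ p) = ≋-refl

coeff₀-* : ∀ p q → coeff₀ (p *ₚ q) ≡ coeff₀ p ∧ coeff₀ q
coeff₀-* []      q = refl
coeff₀-* (a ∷ p) q = trans (coeff-+ (scale a q) (false ∷ (p *ₚ q)) zero)
                            (trans (Bool.xor-identityʳ _) (coeff₀-scale a))
  where
  coeff₀-scale : ∀ a → coeff₀ (scale a q) ≡ a ∧ coeff₀ q
  coeff₀-scale true  = refl
  coeff₀-scale false = refl

r*≋false∷ : ∀ p → r *ₚ p ≋ false ∷ p
r*≋false∷ p = ∷-cong (*-identityˡ p)

r*-cancel : ∀ {p q} → r *ₚ p ≋ r *ₚ q → p ≋ q
r*-cancel {p} {q} e = proj₂ (∷-injective (≋-trans (≋-sym (r*≋false∷ p)) (≋-trans e (r*≋false∷ q))))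

∷≋const+r* : ∀ a p → a ∷ p ≋ const a +ₚ r *ₚ p
∷≋const+r* a p = ≋-sym (≋-trans (+-cong (≋-refl {const a}) (r*≋false∷ p)) (∷-+-false∷ a [] p))

-- Substitution

^-cong : ∀ {x y} n → x ≋ y → x ^ₚ n ≋ y ^ₚ n
^-cong zero    e = ≋-refl
^-cong (suc n) e = *-cong e (^-cong n e)

∘-≋[] : ∀ {p} x → p ≋ [] → p ∘ₚ x ≋ []
∘-≋[] {[]}    x e = ≋-refl
∘-≋[] {a ∷ p} x e with []≋∷ (≋-sym e)
... | refl , e′ = ≋-trans (+-cong false∷[]≋[] (*-congʳ x (∘-≋[] x (≋-sym e′)))) (*-zeroʳ x)

∘-congˡ : ∀ {p p′} x → p ≋ p′ → p ∘ₚ x ≋ p′ ∘ₚ x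
∘-congˡ {[]}    {p′}     x e = ≋-sym (∘-≋[] x (≋-sym e))
∘-congˡ {a ∷ p} {[]}     x e = ∘-≋[] x e
∘-congˡ {a ∷ p} {b ∷ p′} x e with ∷-injective e
... | refl , e′ = +-cong ≋-refl (*-congʳ x (∘-congˡ x e′))

∘-congʳ : ∀ p {x y} → x ≋ y → p ∘ₚ x ≋ p ∘ₚ y
∘-congʳ []      e = ≋-refl
∘-congʳ (a ∷ p) e = +-cong ≋-refl (*-cong e (∘-congʳ p e))

const-∘ : ∀ a x → const a ∘ₚ x ≋ const a
const-∘ a x = ≋-trans (+-cong ≋-refl (*-zeroʳ x)) (+-identityʳ (const a))

r-∘ : ∀ x → r ∘ₚ x ≋ x
r-∘ x = ≋-trans (+-cong false∷[]≋[] (*-congʳ x (const-∘ true x))) (*-identityʳ x)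

+-∘ : ∀ p q x → (p +ₚ q) ∘ₚ x ≋ p ∘ₚ x +ₚ q ∘ₚ x
+-∘ []      q       x = ≋-refl
+-∘ (a ∷ p) []      x = ≋-sym (+-identityʳ _)
+-∘ (a ∷ p) (b ∷ q) x = begin
  (const a +ₚ const b) +ₚ x *ₚ ((p +ₚ q) ∘ₚ x)
    ≈⟨ +-cong ≋-refl (*-congʳ x (+-∘ p q x)) ⟩
  (const a +ₚ const b) +ₚ x *ₚ (p ∘ₚ x +ₚ q ∘ₚ x)
    ≈⟨ solve 5 (λ A B X P Q → (A :+ B) :+ X :* (P :+ Q) := (A :+ X :* P) :+ (B :+ X :* Q))
             ≋-refl (const a) (const b) x (p ∘ₚ x) (q ∘ₚ x) ⟩
  (const a +ₚ x *ₚ (p ∘ₚ x)) +ₚ (const b +ₚ x *ₚ (q ∘ₚ x)) ∎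
  where open SetoidReasoning ≋-setoid

*-∘ : ∀ p q x → (p *ₚ q) ∘ₚ x ≋ p ∘ₚ x *ₚ q ∘ₚ x
*-∘ []      q x = ≋-refl
*-∘ (a ∷ p) q x = begin
  (scale a q +ₚ (false ∷ (p *ₚ q))) ∘ₚ x
    ≈⟨ +-∘ (scale a q) (false ∷ (p *ₚ q)) x ⟩
  scale a q ∘ₚ x +ₚ (const false +ₚ x *ₚ ((p *ₚ q) ∘ₚ x))
    ≈⟨ +-cong (scale-∘ a) (+-cong false∷[]≋[] (*-congʳ x (*-∘ p q x))) ⟩
  const a *ₚ q ∘ₚ x +ₚ x *ₚ (p ∘ₚ x *ₚ q ∘ₚ x)
    ≈⟨ solve 4 (λ A X P Q → A :* Q :+ X :* (P :* Q) := (A :+ X :* P) :* Q)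
             ≋-refl (const a) x (p ∘ₚ x) (q ∘ₚ x) ⟩
  (const a +ₚ x *ₚ (p ∘ₚ x)) *ₚ q ∘ₚ x ∎
  where
  open SetoidReasoning ≋-setoid
  scale-∘ : ∀ a → scale a q ∘ₚ x ≋ const a *ₚ q ∘ₚ x
  scale-∘ true  = ≋-sym (*-identityˡ (q ∘ₚ x))
  scale-∘ false = ≋-sym false∷[]≋[]

^-∘ : ∀ p n x → (p ^ₚ n) ∘ₚ x ≋ (p ∘ₚ x) ^ₚ n
^-∘ p zero    x = const-∘ true x
^-∘ p (suc n) x = ≋-trans (*-∘ p (p ^ₚ n) x) (*-congʳ (p ∘ₚ x) (^-∘ p n x))

∘-assoc : ∀ p q x → (p ∘ₚ q) ∘ₚ x ≋ p ∘ₚ (q ∘ₚ x)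
∘-assoc []      q x = ≋-refl
∘-assoc (a ∷ p) q x = begin
  (const a +ₚ q *ₚ (p ∘ₚ q)) ∘ₚ x          ≈⟨ +-∘ (const a) (q *ₚ (p ∘ₚ q)) x ⟩
  const a ∘ₚ x +ₚ (q *ₚ (p ∘ₚ q)) ∘ₚ x     ≈⟨ +-cong (const-∘ a x) (*-∘ q (p ∘ₚ q) x) ⟩
  const a +ₚ q ∘ₚ x *ₚ (p ∘ₚ q) ∘ₚ x       ≈⟨ +-cong ≋-refl (*-congʳ (q ∘ₚ x) (∘-assoc p q x)) ⟩
  const a +ₚ q ∘ₚ x *ₚ p ∘ₚ (q ∘ₚ x)       ∎
  where open SetoidReasoning ≋-setoid

cubic : Poly → Poly → Poly → Poly → Poly → Poly
cubic a₀ a₁ a₂ a₃ x = a₀ +ₚ a₁ *ₚ x +ₚ a₂ *ₚ (x ^ₚ 2) +ₚ a₃ *ₚ (x ^ₚ 3)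

cubic-cong : ∀ {a₀ a₁ a₂ a₃ b₀ b₁ b₂ b₃ x y} →
             a₀ ≋ b₀ → a₁ ≋ b₁ → a₂ ≋ b₂ → a₃ ≋ b₃ → x ≋ y →
             cubic a₀ a₁ a₂ a₃ x ≋ cubic b₀ b₁ b₂ b₃ y
cubic-cong e₀ e₁ e₂ e₃ e =
  +-cong (+-cong (+-cong e₀ (*-cong e₁ e)) (*-cong e₂ (^-cong 2 e))) (*-cong e₃ (^-cong 3 e))

cubic-∘ : ∀ a₀ a₁ a₂ a₃ x z →
          cubic a₀ a₁ a₂ a₃ x ∘ₚ z ≋ cubic (a₀ ∘ₚ z) (a₁ ∘ₚ z) (a₂ ∘ₚ z) (a₃ ∘ₚ z) (x ∘ₚ z)
cubic-∘ a₀ a₁ a₂ a₃ x z =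
  ≋-trans (+-∘ (a₀ +ₚ a₁ *ₚ x +ₚ a₂ *ₚ (x ^ₚ 2)) (a₃ *ₚ (x ^ₚ 3)) z) (+-cong
    (≋-trans (+-∘ (a₀ +ₚ a₁ *ₚ x) (a₂ *ₚ (x ^ₚ 2)) z) (+-cong
      (≋-trans (+-∘ a₀ (a₁ *ₚ x) z) (+-cong ≋-refl (*-∘ a₁ x z)))
      (monomial-∘ a₂ 2)))
    (monomial-∘ a₃ 3))
  where
  monomial-∘ : ∀ a n → (a *ₚ (x ^ₚ n)) ∘ₚ z ≋ a ∘ₚ z *ₚ ((x ∘ₚ z) ^ₚ n)
  monomial-∘ a n = ≋-trans (*-∘ a (x ^ₚ n) z) (*-congʳ (a ∘ₚ z) (^-∘ x n z))

+-cancelˡ : ∀ p {q s} → p +ₚ q ≋ p +ₚ s → q ≋ s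
+-cancelˡ p {q} {s} e = +≋[]⇒≋ (begin
  q +ₚ s                    ≈⟨ solve 3 (λ P Q S → Q :+ S := (P :+ Q) :+ (P :+ S)) ≋-refl p q s ⟩
  (p +ₚ q) +ₚ (p +ₚ s)      ≈⟨ ≋⇒+≋[] e ⟩
  []                        ∎)
  where open SetoidReasoning ≋-setoid

horner : ∀ a₀ a₁ a₂ a₃ x → a₀ +ₚ x *ₚ (a₁ +ₚ x *ₚ (a₂ +ₚ x *ₚ a₃)) ≋ cubic a₀ a₁ a₂ a₃ x
horner = solve 5 (λ A₀ A₁ A₂ A₃ X → A₀ :+ X :* (A₁ :+ X :* (A₂ :+ X :* A₃))
                                 := A₀ :+ A₁ :* X :+ A₂ :* (X :^ 2) :+ A₃ :* (X :^ 3)) ≋-refl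

cubic-+ : ∀ a₀ a₁ a₂ a₃ b₀ b₁ b₂ b₃ x →
          cubic (a₀ +ₚ b₀) (a₁ +ₚ b₁) (a₂ +ₚ b₂) (a₃ +ₚ b₃) x ≋ cubic a₀ a₁ a₂ a₃ x +ₚ cubic b₀ b₁ b₂ b₃ x
cubic-+ = solve 9 (λ A₀ A₁ A₂ A₃ B₀ B₁ B₂ B₃ X →
                     (A₀ :+ B₀) :+ (A₁ :+ B₁) :* X :+ (A₂ :+ B₂) :* (X :^ 2) :+ (A₃ :+ B₃) :* (X :^ 3)
                  := (A₀ :+ A₁ :* X :+ A₂ :* (X :^ 2) :+ A₃ :* (X :^ 3))
                       :+ (B₀ :+ B₁ :* X :+ B₂ :* (X :^ 2) :+ B₃ :* (X :^ 3))) ≋-refl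

cubic-* : ∀ y a₀ a₁ a₂ a₃ x → cubic (y *ₚ a₀) (y *ₚ a₁) (y *ₚ a₂) (y *ₚ a₃) x ≋ y *ₚ cubic a₀ a₁ a₂ a₃ x
cubic-* = solve 6 (λ Y A₀ A₁ A₂ A₃ X →
                     Y :* A₀ :+ (Y :* A₁) :* X :+ (Y :* A₂) :* (X :^ 2) :+ (Y :* A₃) :* (X :^ 3)
                  := Y :* (A₀ :+ A₁ :* X :+ A₂ :* (X :^ 2) :+ A₃ :* (X :^ 3))) ≋-refl

-- Coordinates Σ gᵢ(y) xⁱ

expand : Poly → Poly → Poly → Poly → Poly → Poly → Poly
expand y g₀ g₁ g₂ g₃ x = cubic (g₀ ∘ₚ y) (g₁ ∘ₚ y) (g₂ ∘ₚ y) (g₃ ∘ₚ y) x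

expand-cong : ∀ {y y′ x x′} g₀ g₁ g₂ g₃ → y ≋ y′ → x ≋ x′ →
              expand y g₀ g₁ g₂ g₃ x ≋ expand y′ g₀ g₁ g₂ g₃ x′
expand-cong g₀ g₁ g₂ g₃ e f =
  cubic-cong (∘-congʳ g₀ e) (∘-congʳ g₁ e) (∘-congʳ g₂ e) (∘-congʳ g₃ e) f

expand-∘ : ∀ y g₀ g₁ g₂ g₃ x z →
           expand y g₀ g₁ g₂ g₃ x ∘ₚ z ≋ expand (y ∘ₚ z) g₀ g₁ g₂ g₃ (x ∘ₚ z)
expand-∘ y g₀ g₁ g₂ g₃ x z =
  ≋-trans (cubic-∘ (g₀ ∘ₚ y) (g₁ ∘ₚ y) (g₂ ∘ₚ y) (g₃ ∘ₚ y) x z)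
          (cubic-cong (∘-assoc g₀ y z) (∘-assoc g₁ y z) (∘-assoc g₂ y z) (∘-assoc g₃ y z) ≋-refl)

record Coordinates (y x g : Poly) : Set where
  field
    A₀ A₁ A₂ A₃ : Poly
    expansion   : g ∘ₚ x ≋ expand y A₀ A₁ A₂ A₃ x

-- When x⁴ = y + x³, multiplying by x shifts coordinates and wraps the top one around.
coordinates : ∀ {x y} → x ^ₚ 4 ≋ y +ₚ x ^ₚ 3 → ∀ g → Coordinates y x g
coordinates rel [] = record { A₀ = [] ; A₁ = [] ; A₂ = [] ; A₃ = [] ; expansion = ≋-refl }
coordinates {x} {y} rel (c ∷ g) = record
  { A₀ = c ∷ A₃ ; A₁ = A₀ ; A₂ = A₁ ; A₃ = A₂ +ₚ A₃ ; expansion = begin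
    const c +ₚ x *ₚ (g ∘ₚ x)
      ≈⟨ +-cong ≋-refl (*-congʳ x expansion) ⟩
    const c +ₚ x *ₚ cubic a₀ a₁ a₂ a₃ x
      ≈⟨ solve 6 (λ C A₀ A₁ A₂ A₃ X →
                  C :+ X :* (A₀ :+ A₁ :* X :+ A₂ :* (X :^ 2) :+ A₃ :* (X :^ 3))
               := C :+ A₀ :* X :+ A₁ :* (X :^ 2) :+ A₂ :* (X :^ 3) :+ A₃ :* (X :^ 4))
               ≋-refl (const c) a₀ a₁ a₂ a₃ x ⟩
    cubic (const c) a₀ a₁ a₂ x +ₚ a₃ *ₚ (x ^ₚ 4)
      ≈⟨ +-cong ≋-refl (*-congʳ a₃ rel) ⟩
    cubic (const c) a₀ a₁ a₂ x +ₚ a₃ *ₚ (y +ₚ x ^ₚ 3)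
      ≈⟨ solve 7 (λ C A₀ A₁ A₂ A₃ X Y →
                  C :+ A₀ :* X :+ A₁ :* (X :^ 2) :+ A₂ :* (X :^ 3) :+ A₃ :* (Y :+ X :^ 3)
               := (C :+ Y :* A₃) :+ A₀ :* X :+ A₁ :* (X :^ 2) :+ (A₂ :+ A₃) :* (X :^ 3))
               ≋-refl (const c) a₀ a₁ a₂ a₃ x y ⟩
    cubic (const c +ₚ y *ₚ a₃) a₀ a₁ (a₂ +ₚ a₃) x
      ≈⟨ +-cong ≋-refl (*-congˡ (x ^ₚ 3) (≋-sym (+-∘ A₂ A₃ y))) ⟩
    expand y (c ∷ A₃) A₀ A₁ (A₂ +ₚ A₃) x ∎ }
  where
  open SetoidReasoning ≋-setoid
  open Coordinates (coordinates {x} {y} rel g)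
  a₀ = A₀ ∘ₚ y
  a₁ = A₁ ∘ₚ y
  a₂ = A₂ ∘ₚ y
  a₃ = A₃ ∘ₚ y

-- The substitution r ↦ r + 1 and the operator U

F∘r+1≋G : F ∘ₚ (r +ₚ one) ≋ G
F∘r+1≋G = by-computation

G∘r+1≋F : G ∘ₚ (r +ₚ one) ≋ F
G∘r+1≋F = by-computation

expand-∘r+1 : ∀ {y y′} g₀ g₁ g₂ g₃ → y ∘ₚ (r +ₚ one) ≋ y′ →
              expand y g₀ g₁ g₂ g₃ r ∘ₚ (r +ₚ one) ≋ expand y′ g₀ g₁ g₂ g₃ (r +ₚ one)
expand-∘r+1 {y} g₀ g₁ g₂ g₃ e =
  ≋-trans (expand-∘ y g₀ g₁ g₂ g₃ r (r +ₚ one)) (expand-cong g₀ g₁ g₂ g₃ e (r-∘ (r +ₚ one)))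

expand-U : ∀ y g₀ g₁ g₂ g₃ x → expand y g₀ (g₁ +ₚ g₃) (g₂ +ₚ g₃) g₃ x ≋
           cubic (g₀ ∘ₚ y) (g₁ ∘ₚ y +ₚ g₃ ∘ₚ y) (g₂ ∘ₚ y +ₚ g₃ ∘ₚ y) (g₃ ∘ₚ y) x
expand-U y g₀ g₁ g₂ g₃ x =
  cubic-cong {a₀ = g₀ ∘ₚ y} {a₃ = g₃ ∘ₚ y} {x = x} ≋-refl (+-∘ g₁ g₃ y) (+-∘ g₂ g₃ y) ≋-refl ≋-refl

trace-∘ : ∀ g₁ g₂ g₃ y → (g₁ +ₚ g₂ +ₚ g₃) ∘ₚ y ≋ g₁ ∘ₚ y +ₚ g₂ ∘ₚ y +ₚ g₃ ∘ₚ y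
trace-∘ g₁ g₂ g₃ y = ≋-trans (+-∘ (g₁ +ₚ g₂) g₃ y) (+-cong (+-∘ g₁ g₂ y) ≋-refl)

-- (x + 1)ⁱ = U(xⁱ) + 1 for i = 1, 2, 3.
expand-+one : ∀ y g₀ g₁ g₂ g₃ x →
              expand y g₀ g₁ g₂ g₃ (x +ₚ one) ≋
              expand y g₀ (g₁ +ₚ g₃) (g₂ +ₚ g₃) g₃ x +ₚ (g₁ +ₚ g₂ +ₚ g₃) ∘ₚ y
expand-+one y g₀ g₁ g₂ g₃ x = begin
  cubic a₀ a₁ a₂ a₃ (x +ₚ one)
    ≈⟨ solve 5 (λ A₀ A₁ A₂ A₃ X →
                A₀ :+ A₁ :* (X :+ con true) :+ A₂ :* ((X :+ con true) :^ 2) :+ A₃ :* ((X :+ con true) :^ 3)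
             := (A₀ :+ (A₁ :+ A₃) :* X :+ (A₂ :+ A₃) :* (X :^ 2) :+ A₃ :* (X :^ 3)) :+ (A₁ :+ A₂ :+ A₃))
             ≋-refl a₀ a₁ a₂ a₃ x ⟩
  cubic a₀ (a₁ +ₚ a₃) (a₂ +ₚ a₃) a₃ x +ₚ (a₁ +ₚ a₂ +ₚ a₃)
    ≈⟨ +-cong (expand-U y g₀ g₁ g₂ g₃ x) (trace-∘ g₁ g₂ g₃ y) ⟨
  expand y g₀ (g₁ +ₚ g₃) (g₂ +ₚ g₃) g₃ x +ₚ (g₁ +ₚ g₂ +ₚ g₃) ∘ₚ y ∎
  where
  open SetoidReasoning ≋-setoid
  a₀ = g₀ ∘ₚ y
  a₁ = g₁ ∘ₚ y
  a₂ = g₂ ∘ₚ y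
  a₃ = g₃ ∘ₚ y

expand-U-+one : ∀ y g₀ g₁ g₂ g₃ x →
                expand y g₀ (g₁ +ₚ g₃) (g₂ +ₚ g₃) g₃ (x +ₚ one) ≋
                expand y g₀ g₁ g₂ g₃ x +ₚ (g₁ +ₚ g₂ +ₚ g₃) ∘ₚ y
expand-U-+one y g₀ g₁ g₂ g₃ x = begin
  expand y g₀ (g₁ +ₚ g₃) (g₂ +ₚ g₃) g₃ (x +ₚ one)
    ≈⟨ expand-U y g₀ g₁ g₂ g₃ (x +ₚ one) ⟩
  cubic a₀ (a₁ +ₚ a₃) (a₂ +ₚ a₃) a₃ (x +ₚ one)
    ≈⟨ solve 5 (λ A₀ A₁ A₂ A₃ X →
                A₀ :+ (A₁ :+ A₃) :* (X :+ con true) :+ (A₂ :+ A₃) :* ((X :+ con true) :^ 2)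
                  :+ A₃ :* ((X :+ con true) :^ 3)
             := (A₀ :+ A₁ :* X :+ A₂ :* (X :^ 2) :+ A₃ :* (X :^ 3)) :+ (A₁ :+ A₂ :+ A₃))
             ≋-refl a₀ a₁ a₂ a₃ x ⟩
  cubic a₀ a₁ a₂ a₃ x +ₚ (a₁ +ₚ a₂ +ₚ a₃)
    ≈⟨ +-cong ≋-refl (trace-∘ g₁ g₂ g₃ y) ⟨
  expand y g₀ g₁ g₂ g₃ x +ₚ (g₁ +ₚ g₂ +ₚ g₃) ∘ₚ y ∎
  where
  open SetoidReasoning ≋-setoid
  a₀ = g₀ ∘ₚ y
  a₁ = g₁ ∘ₚ y
  a₂ = g₂ ∘ₚ y
  a₃ = g₃ ∘ₚ y

UFromDecomp≋expand : ∀ g₀ g₁ g₂ g₃ →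
                     UFromDecomp g₀ g₁ g₂ g₃ ≋ expand F g₀ (g₁ +ₚ g₃) (g₂ +ₚ g₃) g₃ r
UFromDecomp≋expand g₀ g₁ g₂ g₃ = ≋-trans
  (solve 5 (λ B₀ B₁ B₂ B₃ X →
              B₀ :* con true :+ B₁ :* X :+ B₂ :* (X :^ 2) :+ B₃ :* ((X :^ 3) :+ (X :^ 2) :+ X)
           := B₀ :+ (B₁ :+ B₃) :* X :+ (B₂ :+ B₃) :* (X :^ 2) :+ B₃ :* (X :^ 3))
           ≋-refl (g₀ ∘ₚ F) (g₁ ∘ₚ F) (g₂ ∘ₚ F) (g₃ ∘ₚ F) r)
  (≋-sym (expand-U F g₀ g₁ g₂ g₃ r))

U-fixed⇒trace-G≋trace-F : ∀ f g₀ g₁ g₂ g₃ → IsGDecomp f g₀ g₁ g₂ g₃ → f ≈ UFromDecomp g₀ g₁ g₂ g₃ →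
                          (g₁ +ₚ g₂ +ₚ g₃) ∘ₚ G ≋ (g₁ +ₚ g₂ +ₚ g₃) ∘ₚ F
U-fixed⇒trace-G≋trace-F f g₀ g₁ g₂ g₃ f≈expand f≈Uf = +-cancelˡ f (begin
  f +ₚ tr ∘ₚ G                                                  ≈⟨ +-cong f≋expand ≋-refl ⟩
  expand G g₀ g₁ g₂ g₃ r +ₚ tr ∘ₚ G                              ≈⟨ expand-U-+one G g₀ g₁ g₂ g₃ r ⟨
  expand G g₀ (g₁ +ₚ g₃) (g₂ +ₚ g₃) g₃ (r +ₚ one)               ≈⟨ expand-∘r+1 {F} g₀ (g₁ +ₚ g₃) (g₂ +ₚ g₃) g₃ F∘r+1≋G ⟨
  expand F g₀ (g₁ +ₚ g₃) (g₂ +ₚ g₃) g₃ r ∘ₚ (r +ₚ one)          ≈⟨ ∘-congˡ (r +ₚ one) f≋Uexpand ⟨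
  f ∘ₚ (r +ₚ one)                                              ≈⟨ ∘-congˡ (r +ₚ one) f≋expand ⟩
  expand G g₀ g₁ g₂ g₃ r ∘ₚ (r +ₚ one)                          ≈⟨ expand-∘r+1 {G} g₀ g₁ g₂ g₃ G∘r+1≋F ⟩
  expand F g₀ g₁ g₂ g₃ (r +ₚ one)                               ≈⟨ expand-+one F g₀ g₁ g₂ g₃ r ⟩
  expand F g₀ (g₁ +ₚ g₃) (g₂ +ₚ g₃) g₃ r +ₚ tr ∘ₚ F              ≈⟨ +-cong f≋Uexpand ≋-refl ⟨
  f +ₚ tr ∘ₚ F                                                  ∎)
  where
  open SetoidReasoning ≋-setoid
  tr = g₁ +ₚ g₂ +ₚ g₃
  f≋expand : f ≋ expand G g₀ g₁ g₂ g₃ r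
  f≋expand = mk≋ f≈expand
  f≋Uexpand : f ≋ expand F g₀ (g₁ +ₚ g₃) (g₂ +ₚ g₃) g₃ r
  f≋Uexpand = ≋-trans (mk≋ f≈Uf) (UFromDecomp≋expand g₀ g₁ g₂ g₃)

-- Uniqueness of coordinates over ℤ/2[G]

xor≡false⇒≡ : ∀ a b → a xor b ≡ false → a ≡ b
xor≡false⇒≡ false false _ = refl
xor≡false⇒≡ true  true  _ = refl
xor≡false⇒≡ false true  ()
xor≡false⇒≡ true  false ()

coeff-length : ∀ p → coeff p (length p) ≡ false
coeff-length []      = refl
coeff-length (a ∷ p) = coeff-length p

-- A constant multiple of 1 + r has all coefficients equal to the constant; having finite support, it is 0.
p+rp≋const⇒p≋[] : ∀ p d → p +ₚ r *ₚ p ≋ const d → d ≡ false × p ≋ []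
p+rp≋const⇒p≋[] p d p+rp≋d = d≡false , mk≋ λ n → trans (coeff≡d n) d≡false
  where
  e : ∀ n → coeff (p +ₚ (false ∷ p)) n ≡ coeff (const d) n
  e = coeff-≡ (≋-trans (+-cong ≋-refl (≋-sym (r*≋false∷ p))) p+rp≋d)
  coeff≡d : ∀ n → coeff p n ≡ d
  coeff≡d zero    = trans (sym (Bool.xor-identityʳ (coeff p 0))) (trans (sym (coeff-+ p (false ∷ p) 0)) (e 0))
  coeff≡d (suc n) = trans (xor≡false⇒≡ _ _ (trans (sym (coeff-+ p (false ∷ p) (suc n))) (e (suc n))))
                          (coeff≡d n)
  d≡false : d ≡ false
  d≡false = trans (sym (coeff≡d (length p))) (coeff-length p)

G*≋ : ∀ Q → G *ₚ Q ≋ false ∷ false ∷ false ∷ (Q +ₚ r *ₚ Q)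
G*≋ Q = ≋-trans (x³[x+1]*≋ r Q) (≋-trans (r*≋false∷ _) (∷-cong (≋-trans (r*≋false∷ _) (∷-cong (r*≋false∷ _)))))
  where
  x³[x+1]*≋ : ∀ x Q → ((x ^ₚ 3) *ₚ (x +ₚ one)) *ₚ Q ≋ x *ₚ (x *ₚ (x *ₚ (Q +ₚ x *ₚ Q)))
  x³[x+1]*≋ = solve 2 (λ X Q → ((X :^ 3) :* (X :+ con true)) :* Q := X :* (X :* (X :* (Q :+ X :* Q)))) ≋-refl

-- G = r³(1 + r): the r⁰, r¹, r² coefficients see only the remainder, and then r³(d + (1 + r)Q) = 0.
remainder+G*≋[] : ∀ a b c d Q → (a ∷ b ∷ c ∷ d ∷ []) +ₚ G *ₚ Q ≋ [] →
                  (a ≡ false × b ≡ false × c ≡ false × d ≡ false) × Q ≋ []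
remainder+G*≋[] a b c d Q e =
  (xor-false≡false a (E 0) , xor-false≡false b (E 1) , xor-false≡false c (E 2) , proj₁ d≡false×Q≋[]) ,
  proj₂ d≡false×Q≋[]
  where
  E : ∀ n → coeff ((a ∷ b ∷ c ∷ d ∷ []) +ₚ (false ∷ false ∷ false ∷ (Q +ₚ r *ₚ Q))) n ≡ false
  E = coeff-≡ (≋-trans (+-cong (≋-refl {a ∷ b ∷ c ∷ d ∷ []}) (≋-sym (G*≋ Q))) e)
  xor-false≡false : ∀ x → x xor false ≡ false → x ≡ false
  xor-false≡false x = trans (sym (Bool.xor-identityʳ x))
  d+[1+r]Q≋[] : const d +ₚ (Q +ₚ r *ₚ Q) ≋ []
  d+[1+r]Q≋[] = mk≋ λ n → E (suc (suc (suc n)))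
  d≡false×Q≋[] : d ≡ false × Q ≋ []
  d≡false×Q≋[] = p+rp≋const⇒p≋[] Q d (≋-sym (+≋[]⇒≋ d+[1+r]Q≋[]))

digits : ∀ a b c d → cubic (const a) (const b) (const c) (const d) r ≋ a ∷ b ∷ c ∷ d ∷ []
digits a b c d = ≋-sym (begin
  a ∷ b ∷ c ∷ d ∷ []
    ≈⟨ ∷≋const+r* a (b ∷ c ∷ d ∷ []) ⟩
  const a +ₚ r *ₚ (b ∷ c ∷ d ∷ [])
    ≈⟨ +-cong (≋-refl {const a}) (*-congʳ r (≋-trans (∷≋const+r* b (c ∷ d ∷ []))
         (+-cong (≋-refl {const b}) (*-congʳ r (∷≋const+r* c (d ∷ [])))))) ⟩
  const a +ₚ r *ₚ (const b +ₚ r *ₚ (const c +ₚ r *ₚ const d))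
    ≈⟨ horner (const a) (const b) (const c) (const d) r ⟩
  cubic (const a) (const b) (const c) (const d) r ∎)
  where open SetoidReasoning ≋-setoid

expand-G-split : ∀ g₀ g₁ g₂ g₃ → expand G g₀ g₁ g₂ g₃ r ≋
                 (coeff₀ g₀ ∷ coeff₀ g₁ ∷ coeff₀ g₂ ∷ coeff₀ g₃ ∷ []) +ₚ
                 G *ₚ expand G (tailₚ g₀) (tailₚ g₁) (tailₚ g₂) (tailₚ g₃) r
expand-G-split g₀ g₁ g₂ g₃ = begin
  expand G g₀ g₁ g₂ g₃ r
    ≈⟨ cubic-cong {x = r} (split g₀) (split g₁) (split g₂) (split g₃) ≋-refl ⟩
  cubic (const c₀ +ₚ G *ₚ t₀) (const c₁ +ₚ G *ₚ t₁) (const c₂ +ₚ G *ₚ t₂) (const c₃ +ₚ G *ₚ t₃) r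
    ≈⟨ cubic-+ (const c₀) (const c₁) (const c₂) (const c₃) (G *ₚ t₀) (G *ₚ t₁) (G *ₚ t₂) (G *ₚ t₃) r ⟩
  cubic (const c₀) (const c₁) (const c₂) (const c₃) r +ₚ cubic (G *ₚ t₀) (G *ₚ t₁) (G *ₚ t₂) (G *ₚ t₃) r
    ≈⟨ +-cong ≋-refl (cubic-* G t₀ t₁ t₂ t₃ r) ⟩
  cubic (const c₀) (const c₁) (const c₂) (const c₃) r +ₚ G *ₚ cubic t₀ t₁ t₂ t₃ r
    ≈⟨ +-cong (digits c₀ c₁ c₂ c₃) ≋-refl ⟩
  (c₀ ∷ c₁ ∷ c₂ ∷ c₃ ∷ []) +ₚ G *ₚ cubic t₀ t₁ t₂ t₃ r ∎
  where
  open SetoidReasoning ≋-setoid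
  split : ∀ g → g ∘ₚ G ≋ const (coeff₀ g) +ₚ G *ₚ (tailₚ g ∘ₚ G)
  split g = ∘-congˡ G (≋coeff₀∷tailₚ g)
  c₀ = coeff₀ g₀
  c₁ = coeff₀ g₁
  c₂ = coeff₀ g₂
  c₃ = coeff₀ g₃
  t₀ = tailₚ g₀ ∘ₚ G
  t₁ = tailₚ g₁ ∘ₚ G
  t₂ = tailₚ g₂ ∘ₚ G
  t₃ = tailₚ g₃ ∘ₚ G

peel-expand-G≋[] : ∀ g₀ g₁ g₂ g₃ → expand G g₀ g₁ g₂ g₃ r ≋ [] →
  (coeff₀ g₀ ≡ false × coeff₀ g₁ ≡ false × coeff₀ g₂ ≡ false × coeff₀ g₃ ≡ false) ×
  expand G (tailₚ g₀) (tailₚ g₁) (tailₚ g₂) (tailₚ g₃) r ≋ []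
peel-expand-G≋[] g₀ g₁ g₂ g₃ e =
  remainder+G*≋[] (coeff₀ g₀) (coeff₀ g₁) (coeff₀ g₂) (coeff₀ g₃)
    (expand G (tailₚ g₀) (tailₚ g₁) (tailₚ g₂) (tailₚ g₃) r) (≋-trans (≋-sym (expand-G-split g₀ g₁ g₂ g₃)) e)

expand-G≋[]⇒coeff≡false : ∀ n g₀ g₁ g₂ g₃ → expand G g₀ g₁ g₂ g₃ r ≋ [] →
  coeff g₀ n ≡ false × coeff g₁ n ≡ false × coeff g₂ n ≡ false × coeff g₃ n ≡ false
expand-G≋[]⇒coeff≡false zero    g₀ g₁ g₂ g₃ e = proj₁ (peel-expand-G≋[] g₀ g₁ g₂ g₃ e)
expand-G≋[]⇒coeff≡false (suc n) g₀ g₁ g₂ g₃ e =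
  let e₀ , e₁ , e₂ , e₃ = expand-G≋[]⇒coeff≡false n (tailₚ g₀) (tailₚ g₁) (tailₚ g₂) (tailₚ g₃)
                            (proj₂ (peel-expand-G≋[] g₀ g₁ g₂ g₃ e))
  in trans (sym (coeff-tailₚ g₀ n)) e₀ , trans (sym (coeff-tailₚ g₁ n)) e₁ ,
     trans (sym (coeff-tailₚ g₂ n)) e₂ , trans (sym (coeff-tailₚ g₃ n)) e₃

expand-+ : ∀ y g₀ g₁ g₂ g₃ h₀ h₁ h₂ h₃ x →
           expand y (g₀ +ₚ h₀) (g₁ +ₚ h₁) (g₂ +ₚ h₂) (g₃ +ₚ h₃) x ≋
           expand y g₀ g₁ g₂ g₃ x +ₚ expand y h₀ h₁ h₂ h₃ x
expand-+ y g₀ g₁ g₂ g₃ h₀ h₁ h₂ h₃ x =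
  ≋-trans (cubic-cong {x = x} (+-∘ g₀ h₀ y) (+-∘ g₁ h₁ y) (+-∘ g₂ h₂ y) (+-∘ g₃ h₃ y) ≋-refl)
    (cubic-+ (g₀ ∘ₚ y) (g₁ ∘ₚ y) (g₂ ∘ₚ y) (g₃ ∘ₚ y) (h₀ ∘ₚ y) (h₁ ∘ₚ y) (h₂ ∘ₚ y) (h₃ ∘ₚ y) x)

expand-G-injective : ∀ g₀ g₁ g₂ g₃ h₀ h₁ h₂ h₃ →
                     expand G g₀ g₁ g₂ g₃ r ≋ expand G h₀ h₁ h₂ h₃ r →
                     g₀ ≋ h₀ × g₁ ≋ h₁ × g₂ ≋ h₂ × g₃ ≋ h₃
expand-G-injective g₀ g₁ g₂ g₃ h₀ h₁ h₂ h₃ e =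
  +≋[]⇒≋ (mk≋ λ n → proj₁ (zero-at n)) ,
  +≋[]⇒≋ (mk≋ λ n → proj₁ (proj₂ (zero-at n))) ,
  +≋[]⇒≋ (mk≋ λ n → proj₁ (proj₂ (proj₂ (zero-at n)))) ,
  +≋[]⇒≋ (mk≋ λ n → proj₂ (proj₂ (proj₂ (zero-at n))))
  where
  zero-at : ∀ n → coeff (g₀ +ₚ h₀) n ≡ false × coeff (g₁ +ₚ h₁) n ≡ false ×
                  coeff (g₂ +ₚ h₂) n ≡ false × coeff (g₃ +ₚ h₃) n ≡ false
  zero-at n = expand-G≋[]⇒coeff≡false n (g₀ +ₚ h₀) (g₁ +ₚ h₁) (g₂ +ₚ h₂) (g₃ +ₚ h₃)
    (≋-trans (expand-+ G g₀ g₁ g₂ g₃ h₀ h₁ h₂ h₃ r) (≋⇒+≋[] e))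

-- Orders of vanishing at r = 0

coeff₀-∘ : ∀ Y x → coeff₀ x ≡ false → coeff₀ (Y ∘ₚ x) ≡ coeff₀ Y
coeff₀-∘ []      x e = refl
coeff₀-∘ (a ∷ Y) x e = begin
  coeff₀ (const a +ₚ x *ₚ (Y ∘ₚ x))     ≡⟨ coeff-+ (const a) (x *ₚ (Y ∘ₚ x)) zero ⟩
  a xor coeff₀ (x *ₚ (Y ∘ₚ x))          ≡⟨ cong (a xor_) (coeff₀-* x (Y ∘ₚ x)) ⟩
  a xor (coeff₀ x ∧ coeff₀ (Y ∘ₚ x))    ≡⟨ cong (λ b → a xor (b ∧ coeff₀ (Y ∘ₚ x))) e ⟩
  a xor false                          ≡⟨ Bool.xor-identityʳ a ⟩
  a                                    ∎
  where open ≡-Reasoning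

coeff₀≡false⇒∘≋ : ∀ Y x → coeff₀ Y ≡ false → Y ∘ₚ x ≋ x *ₚ (tailₚ Y ∘ₚ x)
coeff₀≡false⇒∘≋ Y x e =
  ≋-trans (∘-congˡ x (≋-trans (≋coeff₀∷tailₚ Y) (≋-reflexive (cong (_∷ tailₚ Y) e))))
          (+-cong false∷[]≋[] ≋-refl)

-- The left side vanishes to order at least 1 + ord Y, the right side to order exactly ord Y.
r*A*Y∘x≋B*Y∘z⇒coeff≡false :
  ∀ {x x₁ z z₁} → x ≋ r *ₚ x₁ → z ≋ r *ₚ z₁ → coeff₀ z₁ ≡ true →
  ∀ n A B Y → coeff₀ B ≡ true → r *ₚ A *ₚ (Y ∘ₚ x) ≋ B *ₚ (Y ∘ₚ z) → coeff Y n ≡ false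
r*A*Y∘x≋B*Y∘z⇒coeff≡false {x} {x₁} {z} {z₁} x≋rx₁ z≋rz₁ z₁₀≡true n A B Y B₀≡true e = go n
  where
  coeff₀z≡false : coeff₀ z ≡ false
  coeff₀z≡false = trans (coeff-≡ z≋rz₁ zero) (coeff₀-* r z₁)

  coeff₀Y≡false : coeff₀ Y ≡ false
  coeff₀Y≡false = begin
    coeff₀ Y                            ≡⟨ coeff₀-∘ Y z coeff₀z≡false ⟨
    coeff₀ (Y ∘ₚ z)                     ≡⟨ cong (_∧ coeff₀ (Y ∘ₚ z)) B₀≡true ⟨
    coeff₀ B ∧ coeff₀ (Y ∘ₚ z)          ≡⟨ coeff₀-* B (Y ∘ₚ z) ⟨
    coeff₀ (B *ₚ (Y ∘ₚ z))              ≡⟨ coeff-≡ e zero ⟨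
    coeff₀ (r *ₚ A *ₚ (Y ∘ₚ x))         ≡⟨ coeff₀-* (r *ₚ A) (Y ∘ₚ x) ⟩
    coeff₀ (r *ₚ A) ∧ coeff₀ (Y ∘ₚ x)   ≡⟨ cong (_∧ coeff₀ (Y ∘ₚ x)) (coeff₀-* r A) ⟩
    false                               ∎
    where open ≡-Reasoning

  W = tailₚ Y ∘ₚ x
  V = tailₚ Y ∘ₚ z

  rearrangeˡ : ∀ X A x₁ W → (X *ₚ A) *ₚ ((X *ₚ x₁) *ₚ W) ≋ X *ₚ ((X *ₚ (A *ₚ x₁)) *ₚ W)
  rearrangeˡ = solve 4 (λ X A x₁ W → (X :* A) :* ((X :* x₁) :* W) := X :* ((X :* (A :* x₁)) :* W)) ≋-refl

  rearrangeʳ : ∀ X B z₁ V → B *ₚ ((X *ₚ z₁) *ₚ V) ≋ X *ₚ ((B *ₚ z₁) *ₚ V)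
  rearrangeʳ = solve 4 (λ X B z₁ V → B :* ((X :* z₁) :* V) := X :* ((B :* z₁) :* V)) ≋-refl

  e′ : r *ₚ (A *ₚ x₁) *ₚ W ≋ (B *ₚ z₁) *ₚ V
  e′ = r*-cancel (begin
    r *ₚ (r *ₚ (A *ₚ x₁) *ₚ W)   ≈⟨ rearrangeˡ r A x₁ W ⟨
    r *ₚ A *ₚ ((r *ₚ x₁) *ₚ W)   ≈⟨ *-congʳ (r *ₚ A) (≋-trans (coeff₀≡false⇒∘≋ Y x coeff₀Y≡false) (*-congˡ W x≋rx₁)) ⟨
    r *ₚ A *ₚ (Y ∘ₚ x)           ≈⟨ e ⟩
    B *ₚ (Y ∘ₚ z)                ≈⟨ *-congʳ B (≋-trans (coeff₀≡false⇒∘≋ Y z coeff₀Y≡false) (*-congˡ V z≋rz₁)) ⟩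
    B *ₚ ((r *ₚ z₁) *ₚ V)        ≈⟨ rearrangeʳ r B z₁ V ⟩
    r *ₚ ((B *ₚ z₁) *ₚ V)        ∎)
    where open SetoidReasoning ≋-setoid

  go : ∀ n → coeff Y n ≡ false
  go zero    = coeff₀Y≡false
  go (suc n) = trans (sym (coeff-tailₚ Y n))
    (r*A*Y∘x≋B*Y∘z⇒coeff≡false x≋rx₁ z≋rz₁ z₁₀≡true n (A *ₚ x₁) (B *ₚ z₁) (tailₚ Y)
      (trans (coeff₀-* B z₁) (cong₂ _∧_ B₀≡true z₁₀≡true)) e′)

G*Y∘G≋F*Y∘F⇒Y≋[] : ∀ Y → G *ₚ (Y ∘ₚ G) ≋ F *ₚ (Y ∘ₚ F) → Y ≋ []
G*Y∘G≋F*Y∘F⇒Y≋[] Y e = mk≋ λ n →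
  r*A*Y∘x≋B*Y∘z⇒coeff≡false {G} {r *ₚ ((r ^ₚ 2) +ₚ r)} {F} {(r +ₚ one) ^ₚ 3}
    G≋r*[r*[r²+r]] ≋-refl refl n ((r ^ₚ 2) +ₚ r) ((r +ₚ one) ^ₚ 3) Y refl
    (r*-cancel (begin
      r *ₚ (r *ₚ ((r ^ₚ 2) +ₚ r) *ₚ (Y ∘ₚ G))    ≈⟨ *-assoc r (r *ₚ ((r ^ₚ 2) +ₚ r)) (Y ∘ₚ G) ⟨
      (r *ₚ (r *ₚ ((r ^ₚ 2) +ₚ r))) *ₚ (Y ∘ₚ G)  ≈⟨ *-congˡ (Y ∘ₚ G) G≋r*[r*[r²+r]] ⟨
      G *ₚ (Y ∘ₚ G)                              ≈⟨ e ⟩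
      F *ₚ (Y ∘ₚ F)                              ≈⟨ *-assoc r ((r +ₚ one) ^ₚ 3) (Y ∘ₚ F) ⟩
      r *ₚ ((r +ₚ one) ^ₚ 3 *ₚ (Y ∘ₚ F))          ∎))
  where
  open SetoidReasoning ≋-setoid
  G≋r*[r*[r²+r]] : G ≋ r *ₚ (r *ₚ ((r ^ₚ 2) +ₚ r))
  G≋r*[r*[r²+r]] = by-computation

-- Odd polynomials in coordinates over ℤ/2[G²]

r⁸≋G²+r⁶ : (r ^ₚ 2) ^ₚ 4 ≋ G ^ₚ 2 +ₚ (r ^ₚ 2) ^ₚ 3
r⁸≋G²+r⁶ = by-computation

G≋r⁴+r³ : G ≋ r ^ₚ 4 +ₚ r ^ₚ 3
G≋r⁴+r³ = by-computation

F≋r⁴+r³+r²+r : F ≋ r ^ₚ 4 +ₚ r ^ₚ 3 +ₚ r ^ₚ 2 +ₚ r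
F≋r⁴+r³+r²+r = by-computation

-- G and F written out as polynomials in x = r.
odd-G-identity : ∀ a₀ a₁ a₂ a₃ x →
  cubic ((x ^ₚ 4 +ₚ x ^ₚ 3) *ₚ a₁ +ₚ ((x ^ₚ 4 +ₚ x ^ₚ 3) ^ₚ 2) *ₚ a₃) a₀
        (a₀ +ₚ (x ^ₚ 4 +ₚ x ^ₚ 3) *ₚ a₂) ((x ^ₚ 4 +ₚ x ^ₚ 3) *ₚ a₃) x
  ≋ (x ^ₚ 2 +ₚ x) *ₚ cubic a₀ a₁ a₂ a₃ (x ^ₚ 2)
odd-G-identity = solve 5 (λ A₀ A₁ A₂ A₃ X →
    ((X :^ 4 :+ X :^ 3) :* A₁ :+ ((X :^ 4 :+ X :^ 3) :^ 2) :* A₃) :+ A₀ :* X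
      :+ (A₀ :+ (X :^ 4 :+ X :^ 3) :* A₂) :* (X :^ 2) :+ ((X :^ 4 :+ X :^ 3) :* A₃) :* (X :^ 3)
  := (X :^ 2 :+ X) :* (A₀ :+ A₁ :* (X :^ 2) :+ A₂ :* ((X :^ 2) :^ 2) :+ A₃ :* ((X :^ 2) :^ 3))) ≋-refl

odd-N2-identity : ∀ a₀ a₁ a₂ x →
  (a₀ +ₚ a₁ +ₚ ((x ^ₚ 4 +ₚ x ^ₚ 3) ^ₚ 2) *ₚ a₂) *ₚ (x ^ₚ 4 +ₚ x ^ₚ 3)
    +ₚ a₀ *ₚ (x ^ₚ 4 +ₚ x ^ₚ 3 +ₚ x ^ₚ 2 +ₚ x)
    +ₚ a₂ *ₚ (((x ^ₚ 4 +ₚ x ^ₚ 3 +ₚ x ^ₚ 2 +ₚ x) ^ₚ 2) *ₚ (x ^ₚ 4 +ₚ x ^ₚ 3))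
  ≋ (x ^ₚ 2 +ₚ x) *ₚ cubic a₀ a₁ a₂ a₂ (x ^ₚ 2)
odd-N2-identity = solve 4 (λ A₀ A₁ A₂ X →
    (A₀ :+ A₁ :+ ((X :^ 4 :+ X :^ 3) :^ 2) :* A₂) :* (X :^ 4 :+ X :^ 3)
      :+ A₀ :* (X :^ 4 :+ X :^ 3 :+ X :^ 2 :+ X)
      :+ A₂ :* (((X :^ 4 :+ X :^ 3 :+ X :^ 2 :+ X) :^ 2) :* (X :^ 4 :+ X :^ 3))
  := (X :^ 2 :+ X) :* (A₀ :+ A₁ :* (X :^ 2) :+ A₂ :* ((X :^ 2) :^ 2) :+ A₂ :* ((X :^ 2) :^ 3))) ≋-refl

-- f = (r² + r) Σ Aᵢ(G²) r²ⁱ ∈ M(odd); the hᵢ are its coordinates over ℤ/2[G].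
module OddElement (A₀ A₁ A₂ A₃ : Poly) where

  B₀ B₁ B₂ B₃ : Poly
  B₀ = A₀ ∘ₚ (r ^ₚ 2)
  B₁ = A₁ ∘ₚ (r ^ₚ 2)
  B₂ = A₂ ∘ₚ (r ^ₚ 2)
  B₃ = A₃ ∘ₚ (r ^ₚ 2)

  h₀ h₁ h₂ h₃ : Poly
  h₀ = r *ₚ B₁ +ₚ (r ^ₚ 2) *ₚ B₃
  h₁ = B₀
  h₂ = B₀ +ₚ r *ₚ B₂
  h₃ = r *ₚ B₃

  a : Poly → Poly
  a A = A ∘ₚ (G ^ₚ 2)

  ∘r²∘G : ∀ A → (A ∘ₚ (r ^ₚ 2)) ∘ₚ G ≋ a A
  ∘r²∘G A = ≋-trans (∘-assoc A (r ^ₚ 2) G) (∘-congʳ A r²∘G≋G²)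
    where
    r²∘G≋G² : (r ^ₚ 2) ∘ₚ G ≋ G ^ₚ 2
    r²∘G≋G² = by-computation

  r*∘r²∘G : ∀ A → (r *ₚ (A ∘ₚ (r ^ₚ 2))) ∘ₚ G ≋ (r ^ₚ 4 +ₚ r ^ₚ 3) *ₚ a A
  r*∘r²∘G A = ≋-trans (*-∘ r (A ∘ₚ (r ^ₚ 2)) G) (*-cong (≋-trans (r-∘ G) G≋r⁴+r³) (∘r²∘G A))

  r²*∘r²∘G : ∀ A → ((r ^ₚ 2) *ₚ (A ∘ₚ (r ^ₚ 2))) ∘ₚ G ≋ ((r ^ₚ 4 +ₚ r ^ₚ 3) ^ₚ 2) *ₚ a A
  r²*∘r²∘G A = ≋-trans (*-∘ (r ^ₚ 2) (A ∘ₚ (r ^ₚ 2)) G) (*-cong r²∘G≋[r⁴+r³]² (∘r²∘G A))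
    where
    r²∘G≋[r⁴+r³]² : (r ^ₚ 2) ∘ₚ G ≋ (r ^ₚ 4 +ₚ r ^ₚ 3) ^ₚ 2
    r²∘G≋[r⁴+r³]² = by-computation

  G-coordinates : ((r ^ₚ 2) +ₚ r) *ₚ expand (G ^ₚ 2) A₀ A₁ A₂ A₃ (r ^ₚ 2) ≋ expand G h₀ h₁ h₂ h₃ r
  G-coordinates = ≋-sym (≋-trans
    (cubic-cong {x = r}
      (≋-trans (+-∘ (r *ₚ B₁) ((r ^ₚ 2) *ₚ B₃) G) (+-cong (r*∘r²∘G A₁) (r²*∘r²∘G A₃)))
      (∘r²∘G A₀)
      (≋-trans (+-∘ B₀ (r *ₚ B₂) G) (+-cong (∘r²∘G A₀) (r*∘r²∘G A₂)))
      (r*∘r²∘G A₃)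
      ≋-refl)
    (odd-G-identity (a A₀) (a A₁) (a A₂) (a A₃) r))

  trace-invariant⇒a₂≋a₃ : (h₁ +ₚ h₂ +ₚ h₃) ∘ₚ G ≋ (h₁ +ₚ h₂ +ₚ h₃) ∘ₚ F → a A₂ ≋ a A₃
  trace-invariant⇒a₂≋a₃ e = +≋[]⇒≋ (begin
    a A₂ +ₚ a A₃          ≈⟨ +-cong (∘r²∘G A₂) (∘r²∘G A₃) ⟨
    B₂ ∘ₚ G +ₚ B₃ ∘ₚ G    ≈⟨ +-∘ B₂ B₃ G ⟨
    (B₂ +ₚ B₃) ∘ₚ G       ≈⟨ ∘-≋[] G (G*Y∘G≋F*Y∘F⇒Y≋[] (B₂ +ₚ B₃) (begin
      G *ₚ ((B₂ +ₚ B₃) ∘ₚ G)     ≈⟨ r*∘ G ⟨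
      (r *ₚ (B₂ +ₚ B₃)) ∘ₚ G     ≈⟨ ∘-congˡ G trace≋ ⟨
      (h₁ +ₚ h₂ +ₚ h₃) ∘ₚ G      ≈⟨ e ⟩
      (h₁ +ₚ h₂ +ₚ h₃) ∘ₚ F      ≈⟨ ∘-congˡ F trace≋ ⟩
      (r *ₚ (B₂ +ₚ B₃)) ∘ₚ F     ≈⟨ r*∘ F ⟩
      F *ₚ ((B₂ +ₚ B₃) ∘ₚ F)     ∎)) ⟩
    []                    ∎)
    where
    open SetoidReasoning ≋-setoid
    trace≋ : h₁ +ₚ h₂ +ₚ h₃ ≋ r *ₚ (B₂ +ₚ B₃)
    trace≋ = solve 4 (λ B₀ B₂ B₃ X → B₀ :+ (B₀ :+ X :* B₂) :+ X :* B₃ := X :* (B₂ :+ B₃)) ≋-refl B₀ B₂ B₃ r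
    r*∘ : ∀ y → (r *ₚ (B₂ +ₚ B₃)) ∘ₚ y ≋ y *ₚ ((B₂ +ₚ B₃) ∘ₚ y)
    r*∘ y = ≋-trans (*-∘ r (B₂ +ₚ B₃) y) (*-congˡ ((B₂ +ₚ B₃) ∘ₚ y) (r-∘ y))

  N2-form : ((A₀ +ₚ A₁ +ₚ (false ∷ A₂)) ∘ₚ (G ^ₚ 2)) *ₚ G +ₚ a A₀ *ₚ F +ₚ a A₂ *ₚ ((F ^ₚ 2) *ₚ G)
            ≋ ((r ^ₚ 2) +ₚ r) *ₚ expand (G ^ₚ 2) A₀ A₁ A₂ A₂ (r ^ₚ 2)
  N2-form = ≋-trans
    (+-cong (+-cong (*-cong coefficient≋ G≋r⁴+r³) (*-congʳ (a A₀) F≋r⁴+r³+r²+r))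
            (*-congʳ (a A₂) (*-cong (^-cong 2 F≋r⁴+r³+r²+r) G≋r⁴+r³)))
    (odd-N2-identity (a A₀) (a A₁) (a A₂) r)
    where
    coefficient≋ : (A₀ +ₚ A₁ +ₚ (false ∷ A₂)) ∘ₚ (G ^ₚ 2) ≋ a A₀ +ₚ a A₁ +ₚ ((r ^ₚ 4 +ₚ r ^ₚ 3) ^ₚ 2) *ₚ a A₂
    coefficient≋ = ≋-trans (+-∘ (A₀ +ₚ A₁) (false ∷ A₂) (G ^ₚ 2))
      (+-cong (+-∘ A₀ A₁ (G ^ₚ 2)) (+-cong false∷[]≋[] (*-congˡ (a A₂) (^-cong 2 G≋r⁴+r³))))

lemma3p3 : (f : Poly) → InK f → InN2 f
lemma3p3 f ((g , f≈odd) , (g₀ , g₁ , g₂ , g₃ , f≈expand , f≈Uf)) =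
  A₀ +ₚ A₁ +ₚ (false ∷ A₂) , A₀ , A₂ , coeff-≡ (≋-sym (begin
    ((A₀ +ₚ A₁ +ₚ (false ∷ A₂)) ∘ₚ (G ^ₚ 2)) *ₚ G +ₚ a A₀ *ₚ F +ₚ a A₂ *ₚ ((F ^ₚ 2) *ₚ G)
      ≈⟨ N2-form ⟩
    ((r ^ₚ 2) +ₚ r) *ₚ expand (G ^ₚ 2) A₀ A₁ A₂ A₂ (r ^ₚ 2)
      ≈⟨ *-congʳ ((r ^ₚ 2) +ₚ r) (+-cong ≋-refl (*-congˡ ((r ^ₚ 2) ^ₚ 3) a₂≋a₃)) ⟩
    ((r ^ₚ 2) +ₚ r) *ₚ expand (G ^ₚ 2) A₀ A₁ A₂ A₃ (r ^ₚ 2)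
      ≈⟨ *-congʳ ((r ^ₚ 2) +ₚ r) expansion ⟨
    ((r ^ₚ 2) +ₚ r) *ₚ (g ∘ₚ (r ^ₚ 2))
      ≈⟨ mk≋ f≈odd ⟨
    f ∎))
  where
  open SetoidReasoning ≋-setoid
  open Coordinates (coordinates {r ^ₚ 2} {G ^ₚ 2} r⁸≋G²+r⁶ g)
  open OddElement A₀ A₁ A₂ A₃

  f≋expand-h : f ≋ expand G h₀ h₁ h₂ h₃ r
  f≋expand-h = ≋-trans (mk≋ f≈odd) (≋-trans (*-congʳ ((r ^ₚ 2) +ₚ r) expansion) G-coordinates)

  g≋h : g₀ ≋ h₀ × g₁ ≋ h₁ × g₂ ≋ h₂ × g₃ ≋ h₃
  g≋h = expand-G-injective g₀ g₁ g₂ g₃ h₀ h₁ h₂ h₃ (≋-trans (≋-sym (mk≋ f≈expand)) f≋expand-h)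

  trace≋ : g₁ +ₚ g₂ +ₚ g₃ ≋ h₁ +ₚ h₂ +ₚ h₃
  trace≋ = let _ , g₁≋h₁ , g₂≋h₂ , g₃≋h₃ = g≋h in +-cong (+-cong g₁≋h₁ g₂≋h₂) g₃≋h₃

  a₂≋a₃ : a A₂ ≋ a A₃
  a₂≋a₃ = trace-invariant⇒a₂≋a₃ (≋-trans (∘-congˡ G (≋-sym trace≋))
    (≋-trans (U-fixed⇒trace-G≋trace-F f g₀ g₁ g₂ g₃ f≈expand f≈Uf) (∘-congˡ F trace≋)))
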